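{- Let ${\bf\Gamma}$ be a class of sets (assigning to each topological space $Z$ a family ${\bf\Gamma}(Z)$ of subsets of $Z$) that is closed under finite intersections and under continuous pre-images. Let $X,Y$ be topological spaces, $\kappa$ a finite natural number, and $A\in{\bf\Gamma}(X\times Y)$ be a union of $\kappa$ rectangles $A_n\times B_n$ ($A_n\subseteq X$, $B_n\subseteq Y$ arbitrary). Then $A$ is the union of at most $2^{2^\kappa}$ rectangles $C\times D$ with $C\in{\bf\Gamma}(X)$ and $D\in{\bf\Gamma}(Y)$. -}

module Defs where

open import Level using (0ℓ)
open import Data.Unit using (⊤; tt)
open import Data.Product using (Σ; ∃; _×_; _,_; proj₁; proj₂)
open import Relation.Unary using (Pred)

Subset : Set → Set₁
Subset A = Pred A 0ℓ

_≐_ : {A : Set} → Subset A → Subset A → Set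
U ≐ V = ∀ a → (U a → V a) × (V a → U a)

_∩_ : {A : Set} → Subset A → Subset A → Subset A
(U ∩ V) a = U a × V a

record Space : Set₂ where
  field
    Carrier  : Set
    Open     : Subset Carrier → Set₁
    open-resp : ∀ {U V} → U ≐ V → Open U → Open V
    open-univ : Open (λ _ → ⊤)
    open-∩    : ∀ {U V} → Open U → Open V → Open (U ∩ V)
    open-⋃    : (I : Set) (U : I → Subset Carrier) →
                (∀ i → Open (U i)) → Open (λ a → ∃ λ i → U i a)

open Space public

Continuous : (Z W : Space) → (Carrier Z → Carrier W) → Set₁
Continuous Z W f = ∀ U → Open W U → Open Z (λ z → U (f z))

ProdOpen : (X Y : Space) → Subset (Carrier X × Carrier Y) → Set₁
ProdOpen X Y W =
  ∀ x y → W (x , y) →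
    Σ (Subset (Carrier X)) λ U → Σ (Subset (Carrier Y)) λ V →
      Open X U × Open Y V × U x × V y ×
      (∀ x' y' → U x' → V y' → W (x' , y'))

_⊗_ : Space → Space → Space
X ⊗ Y = record
  { Carrier   = Carrier X × Carrier Y
  ; Open      = ProdOpen X Y
  ; open-resp = resp
  ; open-univ = λ x y _ → (λ _ → ⊤) , (λ _ → ⊤) , open-univ X , open-univ Y
                          , tt , tt , (λ _ _ _ _ → tt)
  ; open-∩    = inter
  ; open-⋃    = union
  }
  where
  resp : ∀ {U V} → U ≐ V → ProdOpen X Y U → ProdOpen X Y V
  resp {U} {V} eq oU x y v with oU x y (proj₂ (eq (x , y)) v)
  ... | P , Q , oP , oQ , px , qy , sub =
    P , Q , oP , oQ , px , qy ,
    (λ x' y' p q → proj₁ (eq (x' , y')) (sub x' y' p q))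

  inter : ∀ {U V} → ProdOpen X Y U → ProdOpen X Y V → ProdOpen X Y (U ∩ V)
  inter oU oV x y (u , v) with oU x y u | oV x y v
  ... | P , Q , oP , oQ , px , qy , sub | P' , Q' , oP' , oQ' , px' , qy' , sub' =
    (P ∩ P') , (Q ∩ Q') , open-∩ X oP oP' , open-∩ Y oQ oQ' ,
    (px , px') , (qy , qy') ,
    (λ x' y' p q → sub x' y' (proj₁ p) (proj₁ q) , sub' x' y' (proj₂ p) (proj₂ q))

  union : (I : Set) (U : I → Subset (Carrier X × Carrier Y)) →
          (∀ i → ProdOpen X Y (U i)) → ProdOpen X Y (λ a → ∃ λ i → U i a)
  union I U oU x y (i , u) with oU i x y u
  ... | P , Q , oP , oQ , px , qy , sub =
    P , Q , oP , oQ , px , qy , (λ x' y' p q → i , sub x' y' p q)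

Class : Set₂
Class = (Z : Space) → Subset (Carrier Z) → Set₁

RespectsEq : Class → Set₂
RespectsEq Γ = ∀ Z {U V} → U ≐ V → Γ Z U → Γ Z V

ClosedUnder∩ : Class → Set₂
ClosedUnder∩ Γ = ∀ Z {U V} → Γ Z U → Γ Z V → Γ Z (U ∩ V)

ClosedUnderPreimage : Class → Set₂
ClosedUnderPreimage Γ =
  ∀ Z W (f : Carrier Z → Carrier W) → Continuous Z W f →
    ∀ U → Γ W U → Γ Z (λ z → U (f z))

module Submission where

-- The κ sets An split X into at most 2 ^ κ atoms (points lying in the same
-- An's), and membership of (x , y) in A only depends on the atom of x;
-- likewise for Y and the Bn.  The proof therefore runs for an arbitrary
-- Γ-set A that is invariant under classifications of X into M classes and
-- of Y into N classes.  Choose (classically) one representative xS for each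
-- class of X meeting the projection of A, and for it a finite list of
-- representatives y of the classes of Y meeting the section {y ∣ A(xS,y)}.
-- The rectangle for xS is
--     C = ⋂ over those y of {x ∣ A(x,y)},   D = {y ∣ A(xS,y)}.
-- Sections of A are Γ because the slice embeddings are continuous, and
-- finite intersections of Γ-sets are Γ, so these are Γ-rectangles; they
-- lie inside A and cover it by invariance, and there are at most M of them.

open import Defs
open import Level using (0ℓ)
open import Axiom.ExcludedMiddle using (ExcludedMiddle)
open import Data.Nat using (ℕ; zero; suc; _≤_; _^_; z≤n)
open import Data.Nat.Properties
  using (≤-trans; ≤-reflexive; +-mono-≤; m≤m+n; m^n>0; ^-monoʳ-≤)
open import Data.Fin as Fin using (Fin; funToFin; finToFun)
open import Data.Fin.Properties using (finToFun-funToFin)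
open import Data.Maybe using (Maybe; just; nothing)
import Data.Maybe.Relation.Unary.Any as MaybeAny
open import Data.List using (List; []; _∷_; map; mapMaybe; length; lookup; allFin)
open import Data.List.Properties using (length-map; length-mapMaybe; length-tabulate)
open import Data.List.Relation.Unary.All as All using (All; []; _∷_)
open import Data.List.Relation.Unary.All.Properties using (map⁻) renaming (map⁺ to All-map⁺)
open import Data.List.Relation.Unary.Any as Any using (Any; index)
open import Data.List.Relation.Unary.Any.Properties using (map⁺; mapMaybe⁺; lookup-index)
open import Data.List.Membership.Propositional.Properties using (∈-allFin)
open import Data.Product using (Σ; ∃; _×_; _,_; proj₁; proj₂)
open import Data.Empty using (⊥-elim)
open import Relation.Nullary using (Dec; yes; no)
open import Relation.Binary.PropositionalEquality
  using (_≡_; refl; sym; cong; module ≡-Reasoning)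

record Transversal {Z : Set} {N : ℕ} (code : Z → Fin N) (Q : Subset Z) : Set where
  field
    reps  : List (Σ Z Q)
    few   : length reps ≤ N
    meets : ∀ z → Q z → Any (λ r → code (proj₁ r) ≡ code z) reps

-- Every subset has a transversal: for each class decide (classically)
-- whether it meets Q and if so pick a point.
transversal : ExcludedMiddle 0ℓ → {Z : Set} {N : ℕ} (code : Z → Fin N)
  (Q : Subset Z) → Transversal code Q
transversal em {Z} {N} code Q = record
  { reps  = mapMaybe choose (allFin N)
  ; few   = ≤-trans (length-mapMaybe choose (allFin N)) (≤-reflexive (length-tabulate (λ c → c)))
  ; meets = meets
  }
  where
  Meets : Fin N → Set
  Meets c = Σ (Σ Z Q) λ r → code (proj₁ r) ≡ c

  pick : ∀ {c} → Dec (Meets c) → Maybe (Σ Z Q)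
  pick (yes (r , _)) = just r
  pick (no _)        = nothing

  choose : Fin N → Maybe (Σ Z Q)
  choose c = pick (em {Meets c})

  picked : ∀ z → Q z → (d : Dec (Meets (code z))) →
    MaybeAny.Any (λ r → code (proj₁ r) ≡ code z) (pick d)
  picked z q (yes (r , e)) = MaybeAny.just e
  picked z q (no ∄r)       = ⊥-elim (∄r ((z , q) , refl))

  meets : ∀ z → Q z → Any (λ r → code (proj₁ r) ≡ code z) (mapMaybe choose (allFin N))
  meets z q = mapMaybe⁺ choose (allFin N)
    (map⁺ (Any.map (λ { refl → picked z q (em {Meets (code z)}) }) (∈-allFin (code z))))

-- A set is open as soon as each of its points has an open neighbourhood
-- inside it (it is then the union of these neighbourhoods).
open-by-neighbourhoods : (Z : Space) (U : Subset (Carrier Z)) →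
  (∀ z → U z → Σ (Subset (Carrier Z)) λ V → Open Z V × V z × (∀ z' → V z' → U z')) →
  Open Z U
open-by-neighbourhoods Z U nbhd =
  open-resp Z same (open-⋃ Z (Σ (Carrier Z) U) neighbourhood neighbourhood-open)
  where
  neighbourhood : Σ (Carrier Z) U → Subset (Carrier Z)
  neighbourhood (z , u) = proj₁ (nbhd z u)

  neighbourhood-open : ∀ i → Open Z (neighbourhood i)
  neighbourhood-open (z , u) = proj₁ (proj₂ (nbhd z u))

  same : (λ z' → ∃ λ i → neighbourhood i z') ≐ U
  same z' = (λ { ((z , u) , v) → proj₂ (proj₂ (proj₂ (nbhd z u))) z' v })
          , (λ u → (z' , u) , proj₁ (proj₂ (proj₂ (nbhd z' u))))

-- The slice embeddings x ↦ (x , y) and y ↦ (x , y) are continuous: a basic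
-- open rectangle around (x , y) inside W yields a neighbourhood of the
-- point inside the slice.
sliceˡ-continuous : (X Y : Space) (y : Carrier Y) → Continuous X (X ⊗ Y) (λ x → x , y)
sliceˡ-continuous X Y y W W-open = open-by-neighbourhoods X (λ x → W (x , y)) λ x w →
  let (U , V , U-open , _ , Ux , Vy , U×V⊆W) = W-open x y w
  in U , U-open , Ux , λ x' Ux' → U×V⊆W x' y Ux' Vy

sliceʳ-continuous : (X Y : Space) (x : Carrier X) → Continuous Y (X ⊗ Y) (λ y → x , y)
sliceʳ-continuous X Y x W W-open = open-by-neighbourhoods Y (λ y → W (x , y)) λ y w →
  let (U , V , _ , V-open , Ux , Vy , U×V⊆W) = W-open x y w
  in V , V-open , Vy , λ y' Vy' → U×V⊆W x y' Ux Vy'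

⋂ : {Z : Set} → Subset Z → List (Subset Z) → Subset Z
⋂ U []       = U
⋂ U (V ∷ Vs) = U ∩ ⋂ V Vs

⋂-intro : {Z : Set} {z : Z} (U : Subset Z) (Vs : List (Subset Z)) →
  U z → All (λ V → V z) Vs → ⋂ U Vs z
⋂-intro U []       Uz []         = Uz
⋂-intro U (V ∷ Vs) Uz (Vz ∷ Vsz) = Uz , ⋂-intro V Vs Vz Vsz

⋂-head : {Z : Set} {z : Z} (U : Subset Z) (Vs : List (Subset Z)) → ⋂ U Vs z → U z
⋂-head U []       Uz       = Uz
⋂-head U (V ∷ Vs) (Uz , _) = Uz

⋂-elim : {Z : Set} {z : Z} (U : Subset Z) (Vs : List (Subset Z)) →
  ⋂ U Vs z → All (λ V → V z) Vs
⋂-elim U []       _           = []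
⋂-elim U (V ∷ Vs) (_ , ⋂VVsz) = ⋂-head V Vs ⋂VVsz ∷ ⋂-elim V Vs ⋂VVsz

Γ-⋂ : (Γ : Class) → ClosedUnder∩ Γ → (Z : Space) (U : Subset (Carrier Z))
  (Vs : List (Subset (Carrier Z))) → Γ Z U → All (Γ Z) Vs → Γ Z (⋂ U Vs)
Γ-⋂ Γ Γ-∩ Z U []       ΓU []         = ΓU
Γ-⋂ Γ Γ-∩ Z U (V ∷ Vs) ΓU (ΓV ∷ ΓVs) = Γ-∩ Z ΓU (Γ-⋂ Γ Γ-∩ Z V Vs ΓV ΓVs)

module _ (Γ : Class) (X Y : Space) (A : Subset (Carrier X × Carrier Y)) where

  record Rectangle : Set₁ where
    field
      side₁  : Subset (Carrier X)
      side₂  : Subset (Carrier Y)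
      Γside₁ : Γ X side₁
      Γside₂ : Γ Y side₂
      inside : ∀ x y → side₁ x → side₂ y → A (x , y)

  open Rectangle

  Covers : List Rectangle → Set₁
  Covers Rs = ∀ x y → A (x , y) → Any (λ R → side₁ R x × side₂ R y) Rs

  union-of-rectangles : (b : ℕ) (Rs : List Rectangle) → length Rs ≤ b → Covers Rs →
    Σ ℕ λ m → m ≤ b ×
      Σ (Fin m → Subset (Carrier X)) λ C →
      Σ (Fin m → Subset (Carrier Y)) λ D →
        (∀ i → Γ X (C i)) × (∀ i → Γ Y (D i)) ×
        (∀ x y → (A (x , y) → ∃ λ i → C i x × D i y)
               × ((∃ λ i → C i x × D i y) → A (x , y)))
  union-of-rectangles b Rs few covers =
    length Rs , few ,
    (λ i → side₁ (lookup Rs i)) , (λ i → side₂ (lookup Rs i)) ,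
    (λ i → Γside₁ (lookup Rs i)) , (λ i → Γside₂ (lookup Rs i)) ,
    λ x y → (λ a → let hit = covers x y a in index hit , lookup-index hit)
          , (λ { (i , Cx , Dy) → inside (lookup Rs i) x y Cx Dy })

module CoveringTheorem (em : ExcludedMiddle 0ℓ) (Γ : Class) (Γ-∩ : ClosedUnder∩ Γ)
  (Γ-preimage : ClosedUnderPreimage Γ) (X Y : Space)
  (A : Subset (Carrier X × Carrier Y)) (ΓA : Γ (X ⊗ Y) A)
  {M N : ℕ} (codeX : Carrier X → Fin M) (codeY : Carrier Y → Fin N)
  (invariantX : ∀ {x x' y} → codeX x ≡ codeX x' → A (x , y) → A (x' , y))
  (invariantY : ∀ {x y y'} → codeY y ≡ codeY y' → A (x , y) → A (x , y'))
  where

  open Rectangle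

  column : Carrier Y → Subset (Carrier X)
  column y x = A (x , y)

  row : Carrier X → Subset (Carrier Y)
  row x y = A (x , y)

  Γcolumn : ∀ y → Γ X (column y)
  Γcolumn y = Γ-preimage X (X ⊗ Y) _ (sliceˡ-continuous X Y y) A ΓA

  Γrow : ∀ x → Γ Y (row x)
  Γrow x = Γ-preimage Y (X ⊗ Y) _ (sliceʳ-continuous X Y x) A ΓA

  Projection : Subset (Carrier X)
  Projection x = ∃ λ y → A (x , y)

  rowReps : Transversal codeX Projection
  rowReps = transversal em codeX Projection

  -- Including the column at y0 makes the family of columns
  -- nonempty, as Γ(X) need not contain X itself.
  rowTransversal : (xS : Carrier X) → Transversal codeY (row xS)
  rowTransversal xS = transversal em codeY (row xS)

  columns : (xS : Carrier X) → List (Subset (Carrier X))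
  columns xS = map (λ r → column (proj₁ r)) (Transversal.reps (rowTransversal xS))

  rectangleAt : Σ (Carrier X) Projection → Rectangle Γ X Y A
  rectangleAt (xS , y0 , _) = record
    { side₁  = ⋂ (column y0) (columns xS)
    ; side₂  = row xS
    ; Γside₁ = Γ-⋂ Γ Γ-∩ X (column y0) (columns xS) (Γcolumn y0)
                 (All-map⁺ (All.universal (λ r → Γcolumn (proj₁ r)) ys))
    ; Γside₂ = Γrow xS
    ; inside = rectangle-inside
    }
    where
    open Transversal (rowTransversal xS) renaming (reps to ys)

    -- y is in the class of a representative y' of the row of xS, and
    -- A(x , y') holds since x lies in the column of y'.
    rectangle-inside : ∀ x y → ⋂ (column y0) (columns xS) x → row xS y → A (x , y)
    rectangle-inside x y Cx A[xS,y] = All.lookupWith (λ A[x,y'] same → invariantY same A[x,y'])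
      (map⁻ (⋂-elim (column y0) (columns xS) Cx)) (meets y A[xS,y])

  -- A point (x , y) of A lies in the rectangle of the representative xS of
  -- the class of x: A(x , -) and A(xS , -) agree by invariance.
  covered : ∀ x y → A (x , y) → (r : Σ (Carrier X) Projection) → codeX (proj₁ r) ≡ codeX x →
    side₁ (rectangleAt r) x × side₂ (rectangleAt r) y
  covered x y a (xS , y0 , a0) same =
    ⋂-intro (column y0) (columns xS) (invariantX same a0)
      (All-map⁺ (All.universal (λ r → invariantX same (proj₂ r))
                               (Transversal.reps (rowTransversal xS))))
    , invariantX (sym same) a

  rectangles : List (Rectangle Γ X Y A)
  rectangles = map rectangleAt (Transversal.reps rowReps)

  few-rectangles : length rectangles ≤ M
  few-rectangles = ≤-trans (≤-reflexive (length-map rectangleAt (Transversal.reps rowReps)))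
                           (Transversal.few rowReps)

  rectangles-cover : Covers Γ X Y A rectangles
  rectangles-cover x y a = map⁺
    (Any.map (λ {r} → covered x y a r) (Transversal.meets rowReps x (y , a)))

-- The atoms of κ subsets P n of Z: coding each z by the set of n with
-- z ∈ P n classifies Z into at most 2 ^ κ classes, and points with equal
-- codes lie in the same sets P n.
indicator : {P : Set} → Dec P → Fin 2
indicator (yes _) = Fin.suc Fin.zero
indicator (no _)  = Fin.zero

indicator-transfer : {P P' : Set} (d : Dec P) (d' : Dec P') → indicator d ≡ indicator d' → P → P'
indicator-transfer (yes _) (yes p') _  _ = p'
indicator-transfer (yes _) (no _)   () _
indicator-transfer (no ∄p) _        _  p = ⊥-elim (∄p p)

atoms : ExcludedMiddle 0ℓ → {Z : Set} {κ : ℕ} (P : Fin κ → Subset Z) →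
  Σ (Z → Fin (2 ^ κ)) λ code → ∀ {z z'} → code z ≡ code z' → ∀ n → P n z → P n z'
atoms em {Z} P = code , same-atom
  where
  membership : Z → Fin _ → Fin 2
  membership z n = indicator (em {P n z})

  code : Z → Fin _
  code z = funToFin (membership z)

  same-atom : ∀ {z z'} → code z ≡ code z' → ∀ n → P n z → P n z'
  same-atom {z} {z'} same n = indicator-transfer (em {P n z}) (em {P n z'}) (begin
    membership z n          ≡⟨ sym (finToFun-funToFin (membership z) n) ⟩
    finToFun (code z) n     ≡⟨ cong (λ c → finToFun c n) same ⟩
    finToFun (code z') n    ≡⟨ finToFun-funToFin (membership z') n ⟩
    membership z' n         ∎)
    where open ≡-Reasoning

UnionOfRectangles : {U V : Set} (A : Subset (U × V)) {κ : ℕ}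
  (An : Fin κ → Subset U) (Bn : Fin κ → Subset V) → Set
UnionOfRectangles A An Bn =
  ∀ x y → (A (x , y) → ∃ λ n → An n x × Bn n y) × ((∃ λ n → An n x × Bn n y) → A (x , y))

union-invariantˡ : {U V : Set} {A : Subset (U × V)} {κ : ℕ}
  {An : Fin κ → Subset U} {Bn : Fin κ → Subset V} → UnionOfRectangles A An Bn →
  ∀ {x x' y} → (∀ n → An n x → An n x') → A (x , y) → A (x' , y)
union-invariantˡ A≡⋃ {x} {x'} {y} An-x⊆An-x' a =
  let (n , Anx , Bny) = proj₁ (A≡⋃ x y) a
  in proj₂ (A≡⋃ x' y) (n , An-x⊆An-x' n Anx , Bny)

union-invariantʳ : {U V : Set} {A : Subset (U × V)} {κ : ℕ}
  {An : Fin κ → Subset U} {Bn : Fin κ → Subset V} → UnionOfRectangles A An Bn →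
  ∀ {x y y'} → (∀ n → Bn n y → Bn n y') → A (x , y) → A (x , y')
union-invariantʳ A≡⋃ {x} {y} {y'} Bn-y⊆Bn-y' a =
  let (n , Anx , Bny) = proj₁ (A≡⋃ x y) a
  in proj₂ (A≡⋃ x y') (n , Anx , Bn-y⊆Bn-y' n Bny)

n≤2^n : ∀ n → n ≤ 2 ^ n
n≤2^n zero    = z≤n
n≤2^n (suc n) = +-mono-≤ (m^n>0 2 n) (≤-trans (n≤2^n n) (m≤m+n (2 ^ n) 0))

-- Proposition 4.13.  The atoms of the An (resp. Bn) classify X (resp. Y)
-- into at most 2 ^ κ classes under which A is invariant, so the covering
-- theorem yields at most 2 ^ κ ≤ 2 ^ (2 ^ κ) rectangles.

proposition4p13 :
    ExcludedMiddle 0ℓ →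
    (Γ : Class) → RespectsEq Γ → ClosedUnder∩ Γ → ClosedUnderPreimage Γ →
    (X Y : Space) (κ : ℕ)
    (A : Subset (Carrier X × Carrier Y)) → Γ (X ⊗ Y) A →
    (An : Fin κ → Subset (Carrier X)) (Bn : Fin κ → Subset (Carrier Y)) →
    (∀ x y → (A (x , y) → ∃ λ n → An n x × Bn n y)
           × ((∃ λ n → An n x × Bn n y) → A (x , y))) →
    Σ ℕ λ m → m ≤ 2 ^ (2 ^ κ) ×
      Σ (Fin m → Subset (Carrier X)) λ C →
      Σ (Fin m → Subset (Carrier Y)) λ D →
        (∀ i → Γ X (C i)) × (∀ i → Γ Y (D i)) ×
        (∀ x y → (A (x , y) → ∃ λ i → C i x × D i y)
               × ((∃ λ i → C i x × D i y) → A (x , y)))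
proposition4p13 em Γ _ Γ-∩ Γ-preimage X Y κ A ΓA An Bn A≡⋃ =
  union-of-rectangles Γ X Y A (2 ^ (2 ^ κ)) rectangles
    (≤-trans few-rectangles (^-monoʳ-≤ 2 (n≤2^n κ))) rectangles-cover
  where
  atomsX = atoms em An
  atomsY = atoms em Bn
  open CoveringTheorem em Γ Γ-∩ Γ-preimage X Y A ΓA (proj₁ atomsX) (proj₁ atomsY)
    (λ same → union-invariantˡ A≡⋃ (proj₂ atomsX same))
    (λ same → union-invariantʳ A≡⋃ (proj₂ atomsY same))
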